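{- Let $X\subseteq2^\omega$ and $W=\{y\in2^\omega:\exists x\in X\ (y=^*x)\}$, where $y=^*x$ means $y(n)=x(n)$ for all but finitely many $n$. Then $\mathcal{F}_X=\mathcal{F}_W$.
   Context: Subsets of $\omega$ are identified with elements of $2^\omega$. For distinct $x,y\in2^\omega$ let $h(x,y)=\min\{n:x(n)\ne y(n)\}$; for $X\subseteq2^\omega$, $H(X)=\{h(x,y):x,y\in X,x\ne y\}$. The Raisonnier filter $\mathcal{F}_X$ is the set of all $a\subseteq\omega$ for which there is a countable family $\{Y_n:n<\omega\}$ of subsets of $2^\omega$ with $X\subseteq\bigcup_nY_n$ and $a\supseteq\bigcup_nH(Y_n)$. -}

module Defs where

open import Data.Nat using (ℕ; _<_; _≥_)
open import Data.Bool using (Bool; true)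
open import Data.Product using (Σ; _×_)
open import Relation.Binary.PropositionalEquality using (_≡_; _≢_)
open import Relation.Nullary using (¬_)

Cantor : Set
Cantor = ℕ → Bool

SubsetC : Set₁
SubsetC = Cantor → Set

SubsetΩ : Set
SubsetΩ = Cantor

_∈Ω_ : ℕ → SubsetΩ → Set
n ∈Ω a = a n ≡ true

IsH : Cantor → Cantor → ℕ → Set
IsH x y n = (x n ≢ y n) × (∀ m → m < n → x m ≡ y m)

H⊆ : SubsetC → SubsetΩ → Set
H⊆ Y a = ∀ x y → Y x → Y y → x ≢ y → ∀ n → IsH x y n → n ∈Ω a

InRaisonnier : SubsetC → SubsetΩ → Set₁
InRaisonnier X a =
  Σ (ℕ → SubsetC) λ Y →
    (∀ x → X x → Σ ℕ λ n → Y n x) × (∀ n → H⊆ (Y n) a)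

_=*_ : Cantor → Cantor → Set
y =* x = Σ ℕ λ N → ∀ n → n ≥ N → y n ≡ x n

FinMod : SubsetC → SubsetC
FinMod X y = Σ Cantor λ x → X x × (y =* x)

{-# OPTIONS --safe #-}
-- The split point h(x, y) is unchanged when x and y are both translated by the same
-- z ∈ 2^ω (pointwise xor), and every y =* x is a translate of x by a finitely supported z.
-- So if Y₀, Y₁, … witness a ∈ F_X, the countably many translates Yₙ ⊕ z, z finitely
-- supported, cover W and witness a ∈ F_W. Conversely X ⊆ W, and F_X is antitone in X.
module Submission where

open import Defs
open import Data.Bool using (Bool; true; false; _xor_)
open import Data.Bool.Properties using (xor-assoc; xor-comm; xor-same; xor-identityʳ)
open import Data.Nat using (ℕ; zero; suc; _≥_; z≤n; s≤s)
open import Data.Nat.Binary using (ℕᵇ; 2[1+_]; 1+[2_]; toℕ; fromℕ) renaming (zero to 0ᵇ)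
open import Data.Nat.Binary.Properties using (fromℕ-toℕ)
open import Data.Product using (Σ; _×_; _,_; map₁)
open import Function using (_∘_)
open import Function.Definitions using (StrictlySurjective)
open import Relation.Binary.PropositionalEquality
  using (_≡_; _≢_; _≗_; refl; sym; trans; cong; module ≡-Reasoning)

private
  variable
    X X′ : SubsetC
    a : SubsetΩ
    x y : Cantor
    n : ℕ

InRaisonnier-antitone : (∀ x → X x → X′ x) → InRaisonnier X′ a → InRaisonnier X a
InRaisonnier-antitone X⊆X′ (Y , cover , H⊆Y) = Y , (λ x → cover x ∘ X⊆X′ x) , H⊆Y

InRaisonnier-fromCover : {I : Set} (s : ℕ → I) → StrictlySurjective _≡_ s →
  (Z : I → SubsetC) → (∀ x → X x → Σ I λ i → Z i x) → (∀ i → H⊆ (Z i) a) →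
  InRaisonnier X a
InRaisonnier-fromCover {X} s s-surj Z cover H⊆Z = Z ∘ s , coverₛ , H⊆Z ∘ s
  where
  coverₛ : ∀ x → X x → Σ ℕ λ m → Z (s m) x
  coverₛ x Xx with cover x Xx
  ... | i , Zix with s-surj i
  ...   | m , refl = m , Zix

xor-involutiveʳ : ∀ x z → (x xor z) xor z ≡ x
xor-involutiveʳ x z = trans (xor-assoc x z z) (trans (cong (x xor_) (xor-same z)) (xor-identityʳ x))

xor-cancelʳ : ∀ z {x y} → x xor z ≡ y xor z → x ≡ y
xor-cancelʳ z {x} {y} e = begin
  x                ≡⟨ sym (xor-involutiveʳ x z) ⟩
  (x xor z) xor z  ≡⟨ cong (_xor z) e ⟩
  (y xor z) xor z  ≡⟨ xor-involutiveʳ y z ⟩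
  y                ∎
  where open ≡-Reasoning

infixl 6 _⊕_ _⊕ˢ_

_⊕_ : Cantor → Cantor → Cantor
(x ⊕ z) i = x i xor z i

_⊕ˢ_ : SubsetC → Cantor → SubsetC
(Y ⊕ˢ z) y = Σ Cantor λ x → Y x × y ≗ x ⊕ z

IsH⇒≢ : IsH x y n → x ≢ y
IsH⇒≢ (differ , _) refl = differ refl

IsH-cancel-⊕ : ∀ z → IsH (x ⊕ z) (y ⊕ z) n → IsH x y n
IsH-cancel-⊕ {x} {y} {n} z (differ , agree) =
  (λ e → differ (cong (_xor z n) e)) , λ m m<n → xor-cancelʳ (z m) (agree m m<n)

IsH-resp-≗ : ∀ {x′ y′} → x ≗ x′ → y ≗ y′ → IsH x y n → IsH x′ y′ n
IsH-resp-≗ {n = n} x≗x′ y≗y′ (differ , agree) =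
  (λ e → differ (trans (x≗x′ n) (trans e (sym (y≗y′ n))))) ,
  λ m m<n → trans (sym (x≗x′ m)) (trans (agree m m<n) (y≗y′ m))

H⊆-⊕ˢ : ∀ {Y} z → H⊆ Y a → H⊆ (Y ⊕ˢ z) a
H⊆-⊕ˢ z H⊆Y y₁ y₂ (x₁ , Yx₁ , y₁≗) (x₂ , Yx₂ , y₂≗) _ n hy =
  H⊆Y x₁ x₂ Yx₁ Yx₂ (IsH⇒≢ hx) n hx
  where
  hx : IsH x₁ x₂ n
  hx = IsH-cancel-⊕ z (IsH-resp-≗ y₁≗ y₂≗ hy)

-- ℕᵇ is read as its digits in bijective base 2, least significant first: 2 ↦ true, 1 ↦ false.
bits : ℕᵇ → Cantor
bits 0ᵇ       _       = false
bits 2[1+ b ] zero    = true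
bits 1+[2 b ] zero    = false
bits 2[1+ b ] (suc i) = bits b i
bits 1+[2 b ] (suc i) = bits b i

consᵇ : Bool → ℕᵇ → ℕᵇ
consᵇ true  = 2[1+_]
consᵇ false = 1+[2_]

bits-consᵇ-zero : ∀ c b → c ≡ bits (consᵇ c b) zero
bits-consᵇ-zero true  b = refl
bits-consᵇ-zero false b = refl

bits-consᵇ-suc : ∀ c b i → bits (consᵇ c b) (suc i) ≡ bits b i
bits-consᵇ-suc true  b i = refl
bits-consᵇ-suc false b i = refl

eventuallyFalse⇒bits : ∀ N z → (∀ i → i ≥ N → z i ≡ false) → Σ ℕᵇ λ b → z ≗ bits b
eventuallyFalse⇒bits zero    z vanish = 0ᵇ , λ i → vanish i z≤n
eventuallyFalse⇒bits (suc N) z vanish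
  with eventuallyFalse⇒bits N (z ∘ suc) (λ i i≥N → vanish (suc i) (s≤s i≥N))
... | b , tail≗ = consᵇ (z zero) b , λ where
  zero    → bits-consᵇ-zero (z zero) b
  (suc i) → trans (tail≗ i) (sym (bits-consᵇ-suc (z zero) b i))

=*⇒≗⊕bits : y =* x → Σ ℕᵇ λ b → y ≗ x ⊕ bits b
=*⇒≗⊕bits {y} {x} (N , agree) with eventuallyFalse⇒bits N (y ⊕ x) vanish
  where
  vanish : ∀ i → i ≥ N → y i xor x i ≡ false
  vanish i i≥N = trans (cong (_xor x i) (agree i i≥N)) (xor-same (x i))
... | b , y⊕x≗b = b , λ i → begin
  y i                    ≡⟨ sym (xor-involutiveʳ (y i) (x i)) ⟩
  (y i xor x i) xor x i  ≡⟨ xor-comm (y i xor x i) (x i) ⟩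
  x i xor (y i xor x i)  ≡⟨ cong (x i xor_) (y⊕x≗b i) ⟩
  x i xor bits b i       ∎
  where open ≡-Reasoning

pairᵇ : ℕ → ℕᵇ → ℕᵇ
pairᵇ zero    b = 1+[2 b ]
pairᵇ (suc n) b = 2[1+ pairᵇ n b ]

unpairᵇ : ℕᵇ → ℕ × ℕᵇ
unpairᵇ 0ᵇ       = 0 , 0ᵇ
unpairᵇ 1+[2 b ] = 0 , b
unpairᵇ 2[1+ c ] = map₁ suc (unpairᵇ c)

unpairᵇ-pairᵇ : ∀ n b → unpairᵇ (pairᵇ n b) ≡ (n , b)
unpairᵇ-pairᵇ zero    b = refl
unpairᵇ-pairᵇ (suc n) b = cong (map₁ suc) (unpairᵇ-pairᵇ n b)

unpair : ℕ → ℕ × ℕᵇ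
unpair = unpairᵇ ∘ fromℕ

unpair-strictlySurjective : StrictlySurjective _≡_ unpair
unpair-strictlySurjective (n , b) = toℕ (pairᵇ n b) , (begin
  unpairᵇ (fromℕ (toℕ (pairᵇ n b)))  ≡⟨ cong unpairᵇ (fromℕ-toℕ (pairᵇ n b)) ⟩
  unpairᵇ (pairᵇ n b)                ≡⟨ unpairᵇ-pairᵇ n b ⟩
  (n , b)                            ∎)
  where open ≡-Reasoning

InRaisonnier-FinMod : InRaisonnier X a → InRaisonnier (FinMod X) a
InRaisonnier-FinMod {X} {a} (Y , cover , H⊆Y) =
  InRaisonnier-fromCover unpair unpair-strictlySurjective translates coverᵂ H⊆translates
  where
  translates : ℕ × ℕᵇ → SubsetC
  translates (n , b) = Y n ⊕ˢ bits b

  H⊆translates : ∀ i → H⊆ (translates i) a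
  H⊆translates (n , b) = H⊆-⊕ˢ (bits b) (H⊆Y n)

  coverᵂ : ∀ y → FinMod X y → Σ (ℕ × ℕᵇ) λ i → translates i y
  coverᵂ y (x , Xx , y=*x) with cover x Xx | =*⇒≗⊕bits y=*x
  ... | n , Yₙx | b , y≗x⊕b = (n , b) , x , Yₙx , y≗x⊕b

⊆-FinMod : ∀ x → X x → FinMod X x
⊆-FinMod x Xx = x , Xx , 0 , λ _ _ → refl

proposition3p5 : (X : SubsetC) → (a : SubsetΩ) →
    (InRaisonnier X a → InRaisonnier (FinMod X) a) ×
    (InRaisonnier (FinMod X) a → InRaisonnier X a)
proposition3p5 X a = InRaisonnier-FinMod , InRaisonnier-antitone ⊆-FinMod
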